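{- Let $n>1$, let $G_1,\dots,G_n$ be finite simple graphs and $G=G_1\square\cdots\square G_n$ their Cartesian product. (1) If for each $i$ there is $\sigma_i\in\mathrm{Aut}(G_i)$ of order $2$ with $\sigma_i(v)\ne v$ and $v$ not adjacent to $\sigma_i(v)$ for all $v\in V(G_i)$, then $G$ is a $\mathcal{P}$ position of Grim. (2) If each $G_i$ has no isolated vertices and for each $i$ there is $\sigma_i\in\mathrm{Aut}(G_i)$ of order $2$ fixing exactly one vertex of $G_i$ and with $v$ not adjacent to $\sigma_i(v)$ for all $v\in V(G_i)$, then $G$ is an $\mathcal{N}$ position of Grim.
   Context: Grim: two players alternate moves on a finite simple undirected graph. Before play, isolated vertices are deleted. A move consists of choosing a remaining vertex and deleting it together with its incident edges, and then deleting every vertex that has become isolated. The player making the last move wins (a player with no available move loses). A graph is an $\mathcal{N}$ position if the player about to move has a winning strategy, and a $\mathcal{P}$ position otherwise. The Cartesian product $G\square H$ has vertex set $V(G)\times V(H)$, with $(x,y)$ adjacent to $(w,z)$ iff either $x=w$ and $y,z$ are adjacent in $H$, or $y=z$ and $x,w$ are adjacent in $G$. -}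

module Defs where

open import Data.Nat using (ℕ; zero; suc; _*_)
open import Data.Fin using (Fin; zero; suc; _≟_; remQuot)
open import Data.Bool using (Bool; true; false; _∧_; _∨_; not)
open import Data.Bool.Properties using (∧-comm; ∨-comm)
open import Data.List using (allFin)
open import Data.Bool.ListAction using (any)
open import Data.Product using (Σ; ∃; _×_; _,_; proj₁; proj₂)
open import Relation.Nullary using (¬_; yes; no)
open import Relation.Nullary.Decidable using (⌊_⌋)
open import Relation.Binary.PropositionalEquality using (_≡_; refl; sym; cong₂)

record Graph : Set where
  field
    size   : ℕ
    adj    : Fin size → Fin size → Bool
    adjSym : ∀ u v → adj u v ≡ adj v u
    adjIrr : ∀ v → adj v v ≡ false
open Graph public

Vertex : Graph → Set
Vertex G = Fin (size G)

_==_ : ∀ {k} → Fin k → Fin k → Bool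
i == j = ⌊ i ≟ j ⌋

==-sym : ∀ {k} (i j : Fin k) → (i == j) ≡ (j == i)
==-sym i j with i ≟ j | j ≟ i
... | yes _ | yes _ = refl
... | no _  | no _  = refl
... | yes p | no q  with q (sym p)
... | ()
==-sym i j | no p | yes q with p (sym q)
... | ()

==-refl : ∀ {k} (i : Fin k) → (i == i) ≡ true
==-refl i with i ≟ i
... | yes _ = refl
... | no p with p refl
... | ()

-- Cartesian product G □ H, vertex set Fin (|G| * |H|) ≅ V(G) × V(H)
-- via remQuot.  (x,y) ~ (w,z) iff (x = w and y ~ z in H) or (y = z and x ~ w in G).

_□_ : Graph → Graph → Graph
G □ H = record
  { size   = size G * size H
  ; adj    = λ p q → prodAdj (remQuot (size H) p) (remQuot (size H) q)
  ; adjSym = λ p q → prodSym (remQuot (size H) p) (remQuot (size H) q)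
  ; adjIrr = λ p → prodIrr (remQuot (size H) p)
  }
  where
  prodAdj : Vertex G × Vertex H → Vertex G × Vertex H → Bool
  prodAdj (x , y) (w , z) = ((x == w) ∧ adj H y z) ∨ ((y == z) ∧ adj G x w)

  prodSym : ∀ a b → prodAdj a b ≡ prodAdj b a
  prodSym (x , y) (w , z) =
    cong₂ _∨_ (cong₂ _∧_ (==-sym x w) (adjSym H y z))
              (cong₂ _∧_ (==-sym y z) (adjSym G x w))

  prodIrr : ∀ a → prodAdj a a ≡ false
  prodIrr (x , y) rewrite ==-refl x | ==-refl y | adjIrr H y | adjIrr G x = refl

K₁ : Graph
K₁ = record { size = 1 ; adj = λ _ _ → false ; adjSym = λ _ _ → refl ; adjIrr = λ _ → refl }

-- G₁ □ G₂ □ ⋯ □ Gₙ  (the empty product is K₁; for n ≥ 1 this is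
-- G₁ □ (G₂ □ (⋯ □ (Gₙ □ K₁))), isomorphic to G₁ □ ⋯ □ Gₙ)
⨀ : (n : ℕ) → (Fin n → Graph) → Graph
⨀ zero    Gs = K₁
⨀ (suc n) Gs = Gs zero □ ⨀ n (λ i → Gs (suc i))

IsAutomorphism : (G : Graph) → (Vertex G → Vertex G) → Set
IsAutomorphism G σ =
  (Σ (Vertex G → Vertex G) λ τ → (∀ v → τ (σ v) ≡ v) × (∀ v → σ (τ v) ≡ v))
  × (∀ u v → adj G (σ u) (σ v) ≡ adj G u v)

HasOrder2 : (G : Graph) → (Vertex G → Vertex G) → Set
HasOrder2 G σ = (∀ v → σ (σ v) ≡ v) × ¬ (∀ v → σ v ≡ v)

HasIsolatedVertex : Graph → Set
HasIsolatedVertex G = Σ (Vertex G) λ v → ∀ u → adj G v u ≡ false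

-- Grim.  A position of Grim on G is the set S ⊆ V(G) of remaining
-- vertices (always without isolated vertices of the induced subgraph).

VSet : Graph → Set
VSet G = Vertex G → Bool

prune : (G : Graph) → VSet G → VSet G
prune G S u = S u ∧ any (λ w → S w ∧ adj G u w) (allFin (size G))

move : (G : Graph) → VSet G → Vertex G → VSet G
move G S v = prune G (λ u → S u ∧ not (u == v))

start : (G : Graph) → VSet G
start G = prune G (λ _ → true)

mutual
  data Win (G : Graph) : VSet G → Set where
    win : ∀ {S} (v : Vertex G) → S v ≡ true → Lose G (move G S v) → Win G S

  data Lose (G : Graph) : VSet G → Set where
    lose : ∀ {S} → (∀ (v : Vertex G) → S v ≡ true → Win G (move G S v)) → Lose G S

IsNPosition : Graph → Set
IsNPosition G = Win G (start G)

IsPPosition : Graph → Set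
IsPPosition G = Lose G (start G)

-- Tweedledum–Tweedledee.  Let σ be an involutive automorphism with no vertex adjacent to its
-- image.  A position S that is σ-invariant, has no isolated vertices and contains no fixed point
-- of σ is lost for the player to move: whatever vertex v is taken, the reply σ v is still legal
-- (v is not a neighbour of σ v), and deleting v, σ v and the newly isolated vertices leaves a
-- position of the same kind.  If σ has a single fixed point w, the first player deletes w and
-- hands such a position to the opponent.  On G₁ □ ⋯ □ Gₙ the product σ₁ × ⋯ × σₙ is again such
-- an involution; it is fixed-point free as soon as one factor is, and it fixes exactly one
-- vertex when every factor does.
module Submission where

open import Defs
open import Data.Nat using (ℕ; zero; suc; _<_)
open import Data.Fin using (Fin; zero; suc; _≟_; remQuot; combine)
open import Data.Fin.Properties using (remQuot-combine; combine-remQuot; any?)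
open import Data.Fin.Subset using (_⊂_)
open import Data.Fin.Subset.Induction using (⊂-wellFounded)
open import Data.Vec using (tabulate; _[_]=_)
open import Data.Vec.Properties using (lookup∘tabulate; []=⇒lookup; lookup⇒[]=)
open import Data.Bool using (Bool; true; false; T; T?; not; _∧_; _∨_)
open import Data.Bool.Properties using (T-≡; T-∧; T-∨; ∧-zeroʳ; ¬-not)
open import Data.Bool.ListAction using (any)
open import Data.List using (allFin)
open import Data.List.Membership.Propositional using () renaming (lose to ∈-lose)
open import Data.List.Membership.Propositional.Properties using (∈-allFin)
open import Data.List.Relation.Unary.Any using (satisfied)
open import Data.List.Relation.Unary.Any.Properties using (any⁺; any⁻)
open import Data.Product using (Σ; ∃; _×_; _,_; proj₁; proj₂; uncurry; map)
open import Data.Sum using (inj₂)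
open import Data.Empty using (⊥-elim)
open import Function using (_∘_; id; _⇔_; mk⇔; Equivalence)
open import Induction.WellFounded using (WellFounded; Acc; acc)
open import Relation.Binary.Construct.On as On using ()
open import Relation.Nullary using (¬_; yes; no)
open import Relation.Nullary.Decidable using (fromWitnessFalse; toWitnessFalse)
open import Relation.Binary.PropositionalEquality
  using (_≡_; _≢_; refl; sym; trans; cong; cong₂; subst; module ≡-Reasoning)

open Equivalence using (to; from)

infix 4 _∋_ _⊆_ _≐_ _⊏_

-- A record rather than T (S u), so that S and u can be inferred from a membership proof.
record _∋_ {k} (S : Fin k → Bool) (u : Fin k) : Set where
  constructor ∋-intro
  field ∋-holds : T (S u)
open _∋_

_⊆_ : ∀ {k} → (Fin k → Bool) → (Fin k → Bool) → Set
X ⊆ Y = ∀ {u} → X ∋ u → Y ∋ u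

_≐_ : ∀ {k} → (Fin k → Bool) → (Fin k → Bool) → Set
X ≐ Y = ∀ {u} → X ∋ u ⇔ Y ∋ u

_─_ : ∀ {k} → (Fin k → Bool) → Fin k → Fin k → Bool
(S ─ v) u = S u ∧ not (u == v)

─⁺ : ∀ {k} {S : Fin k → Bool} {u v} → S ∋ u → u ≢ v → (S ─ v) ∋ u
─⁺ (∋-intro su) u≢v = ∋-intro (from T-∧ (su , fromWitnessFalse u≢v))

─⁻ : ∀ {k} {S : Fin k → Bool} {u v} → (S ─ v) ∋ u → S ∋ u × u ≢ v
─⁻ (∋-intro p) = map ∋-intro toWitnessFalse (to T-∧ p)

_⊏_ : ∀ {k} → (Fin k → Bool) → (Fin k → Bool) → Set
X ⊏ Y = tabulate X ⊂ tabulate Y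

⊏-wellFounded : ∀ {k} → WellFounded (_⊏_ {k})
⊏-wellFounded = On.wellFounded tabulate ⊂-wellFounded

⊏-intro : ∀ {k} {X Y : Fin k → Bool} {v} → X ⊆ Y → Y ∋ v → ¬ X ∋ v → X ⊏ Y
⊏-intro {v = v} X⊆Y yv ¬xv =
  ∈-tabulate⁺ ∘ X⊆Y ∘ ∈-tabulate⁻ , v , ∈-tabulate⁺ yv , ¬xv ∘ ∈-tabulate⁻
  where
  ∈-tabulate⁺ : ∀ {S : Fin _ → Bool} {i} → S ∋ i → tabulate S [ i ]= true
  ∈-tabulate⁺ {S} {i} (∋-intro si) = lookup⇒[]= i _ (trans (lookup∘tabulate S i) (to T-≡ si))

  ∈-tabulate⁻ : ∀ {S : Fin _ → Bool} {i} → tabulate S [ i ]= true → S ∋ i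
  ∈-tabulate⁻ {S} {i} p = ∋-intro (from T-≡ (trans (sym (lookup∘tabulate S i)) ([]=⇒lookup p)))

==-injective : ∀ {k} {f : Fin k → Fin k} → (∀ {u w} → f u ≡ f w → u ≡ w) →
               ∀ u w → (f u == f w) ≡ (u == w)
==-injective {f = f} inj u w with u ≟ w | f u ≟ f w
... | yes refl | yes _   = refl
... | yes refl | no ¬refl = ⊥-elim (¬refl refl)
... | no u≢w   | yes e   = ⊥-elim (u≢w (inj e))
... | no _     | no _    = refl

Adjacent : (G : Graph) → Vertex G → Vertex G → Set
Adjacent G u w = T (adj G u w)

NeighbourIn : (G : Graph) → VSet G → Vertex G → Set
NeighbourIn G X u = Σ (Vertex G) λ w → X ∋ w × Adjacent G u w

module Pruning (G : Graph) where

  adjacent-sym : ∀ {u w} → Adjacent G u w → Adjacent G w u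
  adjacent-sym {u} {w} = subst T (adjSym G u w)

  prune⁺ : ∀ {X : VSet G} {u w} → X ∋ u → X ∋ w → Adjacent G u w → prune G X ∋ u
  prune⁺ {w = w} (∋-intro xu) (∋-intro xw) uw =
    ∋-intro (from T-∧ (xu , any⁺ _ (∈-lose (∈-allFin w) (from T-∧ (xw , uw)))))

  prune⁻ : ∀ {X : VSet G} {u} → prune G X ∋ u → X ∋ u × NeighbourIn G X u
  prune⁻ (∋-intro p) =
    let xu , found = to T-∧ p
        w , xw-uw  = satisfied (any⁻ _ (allFin (size G)) found)
        xw , uw    = to T-∧ xw-uw
    in ∋-intro xu , w , ∋-intro xw , uw

  prune⊆ : ∀ {X : VSet G} → prune G X ⊆ X
  prune⊆ = proj₁ ∘ prune⁻

  prune-neighbour : ∀ {X : VSet G} {u} → prune G X ∋ u → NeighbourIn G (prune G X) u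
  prune-neighbour p =
    let xu , w , xw , uw = prune⁻ p in w , prune⁺ xw xu (adjacent-sym uw) , uw

  -- A vertex of X ─ v with a neighbour in X ─ v survives the inner pruning, so it may be skipped.
  prune-─-prune : ∀ {X : VSet G} {v} → prune G (prune G X ─ v) ≐ prune G (X ─ v)
  prune-─-prune = mk⇔ shrink grow
    where
    shrink : ∀ {X v u} → prune G (prune G X ─ v) ∋ u → prune G (X ─ v) ∋ u
    shrink p with prune⁻ p
    ... | pu , w , pw , uw with ─⁻ pu | ─⁻ pw
    ... | xu , u≢v | xw , w≢v = prune⁺ (─⁺ (prune⊆ xu) u≢v) (─⁺ (prune⊆ xw) w≢v) uw

    grow : ∀ {X v u} → prune G (X ─ v) ∋ u → prune G (prune G X ─ v) ∋ u
    grow p with prune⁻ p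
    ... | pu , w , pw , uw with ─⁻ pu | ─⁻ pw
    ... | xu , u≢v | xw , w≢v =
      prune⁺ (─⁺ (prune⁺ xu xw uw) u≢v) (─⁺ (prune⁺ xw xu (adjacent-sym uw)) w≢v) uw

  move⁻ : ∀ {S : VSet G} {v u} → move G S v ∋ u → S ∋ u × u ≢ v
  move⁻ = ─⁻ ∘ prune⊆

  neighbour : ¬ HasIsolatedVertex G → ∀ v → ∃ (Adjacent G v)
  neighbour noIsolated v with any? (λ u → T? (adj G v u))
  ... | yes found = found
  ... | no none   = ⊥-elim (noIsolated (v , λ u → ¬-not (λ vu → none (u , from T-≡ vu))))

  start-∋ : ¬ HasIsolatedVertex G → ∀ v → start G ∋ v
  start-∋ noIsolated v = let _ , vu = neighbour noIsolated v in prune⁺ (∋-intro _) (∋-intro _) vu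

record MirrorInvolution (G : Graph) : Set where
  field
    σ                  : Vertex G → Vertex G
    involutive         : ∀ v → σ (σ v) ≡ v
    preserves-adj      : ∀ u v → adj G (σ u) (σ v) ≡ adj G u v
    image-not-adjacent : ∀ v → adj G v (σ v) ≡ false

  σ-injective : ∀ {u w} → σ u ≡ σ w → u ≡ w
  σ-injective {u} {w} e = trans (sym (involutive u)) (trans (cong σ e) (involutive w))

FixedPointFree : {A : Set} → (A → A) → Set
FixedPointFree f = ∀ v → f v ≢ v

UniqueFixedPoint : {A : Set} → (A → A) → Set
UniqueFixedPoint {A} f = Σ A λ w → f w ≡ w × (∀ u → f u ≡ u → u ≡ w)

module Mirroring {G : Graph} (m : MirrorInvolution G) where
  open MirrorInvolution m
  open Pruning G

  σ-Closed : VSet G → Set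
  σ-Closed X = ∀ {u} → X ∋ u → X ∋ σ u

  record MirrorPosition (S : VSet G) : Set where
    field
      σ-closed    : σ-Closed S
      no-isolated : ∀ {u} → S ∋ u → NeighbourIn G S u
      no-fixed    : ∀ {u} → S ∋ u → σ u ≢ u

  σ-adjacent : ∀ {u w} → Adjacent G u w → Adjacent G (σ u) (σ w)
  σ-adjacent {u} {w} = subst T (sym (preserves-adj u w))

  ¬adjacent-image : ∀ v → ¬ Adjacent G v (σ v)
  ¬adjacent-image v = subst T (image-not-adjacent v)

  prune-σ-closed : ∀ {X} → σ-Closed X → σ-Closed (prune G X)
  prune-σ-closed closed p =
    let xu , w , xw , uw = prune⁻ p in prune⁺ (closed xu) (closed xw) (σ-adjacent uw)

  ─-pair-σ-closed : ∀ {S v} → σ-Closed S → σ-Closed ((S ─ v) ─ σ v)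
  ─-pair-σ-closed {v = v} closed p with ─⁻ p
  ... | su′ , u≢σv with ─⁻ su′
  ... | su , u≢v =
    ─⁺ (─⁺ (closed su) (λ σu≡v → u≢σv (trans (sym (involutive _)) (cong σ σu≡v))))
       (u≢v ∘ σ-injective)

  ─-fixed-σ-closed : ∀ {S w} → σ w ≡ w → σ-Closed S → σ-Closed (S ─ w)
  ─-fixed-σ-closed {w = w} σw≡w closed p with ─⁻ p
  ... | su , u≢w = ─⁺ (closed su) (λ σu≡w → u≢w (σ-injective (trans σu≡w (sym σw≡w))))

  mirrorPosition-prune : ∀ {X Y} → σ-Closed X → (∀ {u} → X ∋ u → σ u ≢ u) →
                         Y ≐ prune G X → MirrorPosition Y
  mirrorPosition-prune closed fixed-free Y≐ = record
    { σ-closed    = from Y≐ ∘ prune-σ-closed closed ∘ to Y≐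
    ; no-isolated = λ yu → let w , pw , uw = prune-neighbour (to Y≐ yu) in w , from Y≐ pw , uw
    ; no-fixed    = fixed-free ∘ prune⊆ ∘ to Y≐
    }

  module Reply {S : VSet G} (ms : MirrorPosition S) {v} (sv : S ∋ v) where
    open MirrorPosition ms

    reply-legal : move G S v ∋ σ v
    reply-legal with no-isolated (σ-closed sv)
    ... | w , sw , σv∼w = prune⁺ (─⁺ (σ-closed sv) (no-fixed sv)) (─⁺ sw w≢v) σv∼w
      where
      w≢v : w ≢ v
      w≢v w≡v = ¬adjacent-image v (adjacent-sym (subst (Adjacent G (σ v)) w≡v σv∼w))

    reply-mirrorPosition : MirrorPosition (move G (move G S v) (σ v))
    reply-mirrorPosition =
      mirrorPosition-prune (─-pair-σ-closed σ-closed) (no-fixed ∘ proj₁ ∘ ─⁻ ∘ proj₁ ∘ ─⁻)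
        prune-─-prune

    reply-⊏ : move G (move G S v) (σ v) ⊏ S
    reply-⊏ = ⊏-intro (proj₁ ∘ move⁻ ∘ proj₁ ∘ move⁻) sv
                      (λ p → proj₂ (move⁻ (proj₁ (move⁻ p))) refl)

  mirrorPosition⇒Lose : ∀ {S} → MirrorPosition S → Lose G S
  mirrorPosition⇒Lose {S} = go (⊏-wellFounded S)
    where
    go : ∀ {S} → Acc _⊏_ S → MirrorPosition S → Lose G S
    go (acc smaller) ms = lose λ v sv →
      let open Reply ms (∋-intro (from T-≡ sv))
      in win (σ v) (to T-≡ (∋-holds reply-legal)) (go (smaller reply-⊏) reply-mirrorPosition)

  fixedPointFree⇒P : FixedPointFree σ → IsPPosition G
  fixedPointFree⇒P fixed-free =
    mirrorPosition⇒Lose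
      (mirrorPosition-prune (λ _ → ∋-intro _) (λ {u} _ → fixed-free u) (mk⇔ id id))

  uniqueFixedPoint⇒N : (fp : UniqueFixedPoint σ) → start G ∋ proj₁ fp → IsNPosition G
  uniqueFixedPoint⇒N (w , σw≡w , unique) sw =
    win w (to T-≡ (∋-holds sw))
      (mirrorPosition⇒Lose
        (mirrorPosition-prune (─-fixed-σ-closed σw≡w (λ _ → ∋-intro _))
          (λ {u} p σu≡u → proj₂ (─⁻ p) (unique u σu≡u)) prune-─-prune))

module Product (G H : Graph) where
  open Pruning G using (neighbour)

  coordinates : Vertex (G □ H) → Vertex G × Vertex H
  coordinates = remQuot (size H)

  vertex : Vertex G × Vertex H → Vertex (G □ H)
  vertex = uncurry combine

  coordinates-vertex : ∀ r → coordinates (vertex r) ≡ r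
  coordinates-vertex = uncurry remQuot-combine

  vertex-coordinates : ∀ p → vertex (coordinates p) ≡ p
  vertex-coordinates = combine-remQuot {size G} (size H)

  adj× : Vertex G × Vertex H → Vertex G × Vertex H → Bool
  adj× (x , y) (w , z) = ((x == w) ∧ adj H y z) ∨ ((y == z) ∧ adj G x w)

  ¬HasIsolatedVertex-□ˡ : ¬ HasIsolatedVertex G → ¬ HasIsolatedVertex (G □ H)
  ¬HasIsolatedVertex-□ˡ noIsolated (p , isolated) =
    let x , y  = coordinates p
        a , xa = neighbour noIsolated x
        p∼ay : Adjacent (G □ H) p (vertex (a , y))
        p∼ay = subst (λ r → T (adj× (x , y) r)) (sym (coordinates-vertex (a , y)))
                     (from T-∨ (inj₂ (from T-∧ (from T-≡ (==-refl y) , xa))))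
    in subst T (isolated (vertex (a , y))) p∼ay

  module _ (mG : MirrorInvolution G) (mH : MirrorInvolution H) where
    private
      module G = MirrorInvolution mG
      module H = MirrorInvolution mH

    σ× : Vertex G × Vertex H → Vertex G × Vertex H
    σ× = map G.σ H.σ

    σ□ : Vertex (G □ H) → Vertex (G □ H)
    σ□ = vertex ∘ σ× ∘ coordinates

    coordinates-σ□ : ∀ p → coordinates (σ□ p) ≡ σ× (coordinates p)
    coordinates-σ□ p = coordinates-vertex (σ× (coordinates p))

    σ□-involutive : ∀ p → σ□ (σ□ p) ≡ p
    σ□-involutive p = begin
      vertex (σ× (coordinates (σ□ p)))  ≡⟨ cong (vertex ∘ σ×) (coordinates-σ□ p) ⟩
      vertex (σ× (σ× (x , y)))          ≡⟨ cong₂ combine (G.involutive x) (H.involutive y) ⟩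
      vertex (x , y)                    ≡⟨ vertex-coordinates p ⟩
      p                                 ∎
      where
      open ≡-Reasoning
      x = proj₁ (coordinates p)
      y = proj₂ (coordinates p)

    adj×-σ× : ∀ r s → adj× (σ× r) (σ× s) ≡ adj× r s
    adj×-σ× (x , y) (w , z) =
      cong₂ _∨_ (cong₂ _∧_ (==-injective G.σ-injective x w) (H.preserves-adj y z))
                (cong₂ _∧_ (==-injective H.σ-injective y z) (G.preserves-adj x w))

    adj×-image : ∀ r → adj× r (σ× r) ≡ false
    adj×-image (x , y) =
      cong₂ _∨_ (trans (cong ((x == G.σ x) ∧_) (H.image-not-adjacent y)) (∧-zeroʳ _))
                (trans (cong ((y == H.σ y) ∧_) (G.image-not-adjacent x)) (∧-zeroʳ _))

    mirror : MirrorInvolution (G □ H)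
    mirror = record
      { σ                  = σ□
      ; involutive         = σ□-involutive
      ; preserves-adj      = λ p q → trans (cong₂ adj× (coordinates-σ□ p) (coordinates-σ□ q))
                                           (adj×-σ× (coordinates p) (coordinates q))
      ; image-not-adjacent = λ p → trans (cong (adj× (coordinates p)) (coordinates-σ□ p))
                                         (adj×-image (coordinates p))
      }

    fixed-σ× : ∀ {p} → σ□ p ≡ p → σ× (coordinates p) ≡ coordinates p
    fixed-σ× {p} e = trans (sym (coordinates-σ□ p)) (cong coordinates e)

    fixedPointFree-σ□ : FixedPointFree G.σ → FixedPointFree σ□
    fixedPointFree-σ□ fixed-free p = fixed-free _ ∘ cong proj₁ ∘ fixed-σ×

    uniqueFixedPoint-σ□ : UniqueFixedPoint G.σ → UniqueFixedPoint H.σ → UniqueFixedPoint σ□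
    uniqueFixedPoint-σ□ (a , σa≡a , uniqueG) (b , σb≡b , uniqueH) = vertex (a , b) , fixed , unique
      where
      fixed : σ□ (vertex (a , b)) ≡ vertex (a , b)
      fixed = trans (cong (vertex ∘ σ×) (coordinates-vertex (a , b))) (cong₂ combine σa≡a σb≡b)

      unique : ∀ p → σ□ p ≡ p → p ≡ vertex (a , b)
      unique p e = trans (sym (vertex-coordinates p))
        (cong₂ combine (uniqueG _ (cong proj₁ (fixed-σ× e))) (uniqueH _ (cong proj₂ (fixed-σ× e))))

K₁-mirror : MirrorInvolution K₁
K₁-mirror = record
  { σ                  = id
  ; involutive         = λ _ → refl
  ; preserves-adj      = λ _ _ → refl
  ; image-not-adjacent = λ _ → refl
  }

⨀-mirror : ∀ n {Gs : Fin n → Graph} → (∀ i → MirrorInvolution (Gs i)) → MirrorInvolution (⨀ n Gs)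
⨀-mirror zero    ms = K₁-mirror
⨀-mirror (suc n) ms = Product.mirror _ _ (ms zero) (⨀-mirror n (ms ∘ suc))

⨀-fixedPointFree : ∀ n {Gs : Fin (suc n) → Graph} (ms : ∀ i → MirrorInvolution (Gs i)) →
  FixedPointFree (MirrorInvolution.σ (ms zero)) →
  FixedPointFree (MirrorInvolution.σ (⨀-mirror (suc n) ms))
⨀-fixedPointFree n ms = Product.fixedPointFree-σ□ _ _ (ms zero) (⨀-mirror n (ms ∘ suc))

⨀-uniqueFixedPoint : ∀ n {Gs : Fin n → Graph} (ms : ∀ i → MirrorInvolution (Gs i)) →
  (∀ i → UniqueFixedPoint (MirrorInvolution.σ (ms i))) →
  UniqueFixedPoint (MirrorInvolution.σ (⨀-mirror n ms))
⨀-uniqueFixedPoint zero    ms unique = zero , refl , λ { zero _ → refl }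
⨀-uniqueFixedPoint (suc n) ms unique =
  Product.uniqueFixedPoint-σ□ _ _ (ms zero) (⨀-mirror n (ms ∘ suc))
    (unique zero) (⨀-uniqueFixedPoint n (ms ∘ suc) (unique ∘ suc))

MirrorWitness : (G : Graph) → ((Vertex G → Vertex G) → Set) → Set
MirrorWitness G P = Σ (Vertex G → Vertex G) λ σ →
  IsAutomorphism G σ × HasOrder2 G σ × P σ × (∀ v → adj G v (σ v) ≡ false)

mirrorInvolution : ∀ G {P} → MirrorWitness G P → MirrorInvolution G
mirrorInvolution G (σ , (_ , preserves) , (involutive , _) , _ , nonadjacent) =
  record
    { σ                  = σ
    ; involutive         = involutive
    ; preserves-adj      = preserves
    ; image-not-adjacent = nonadjacent
    }

fixedPointCondition : ∀ G {P} (h : MirrorWitness G P) →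
                      P (MirrorInvolution.σ (mirrorInvolution G h))
fixedPointCondition G (_ , _ , _ , p , _) = p

⨀-P-position : ∀ n (Gs : Fin (suc n) → Graph) →
  (∀ i → MirrorWitness (Gs i) FixedPointFree) → IsPPosition (⨀ (suc n) Gs)
⨀-P-position n Gs h =
  Mirroring.fixedPointFree⇒P (⨀-mirror (suc n) ms)
    (⨀-fixedPointFree n ms (fixedPointCondition (Gs zero) (h zero)))
  where
  ms : ∀ i → MirrorInvolution (Gs i)
  ms i = mirrorInvolution (Gs i) (h i)

⨀-N-position : ∀ n (Gs : Fin (suc n) → Graph) → (∀ i → ¬ HasIsolatedVertex (Gs i)) →
  (∀ i → MirrorWitness (Gs i) UniqueFixedPoint) → IsNPosition (⨀ (suc n) Gs)
⨀-N-position n Gs noIsolated h =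
  Mirroring.uniqueFixedPoint⇒N (⨀-mirror (suc n) ms)
    (⨀-uniqueFixedPoint (suc n) ms (λ i → fixedPointCondition (Gs i) (h i)))
    (Pruning.start-∋ (⨀ (suc n) Gs)
      (Product.¬HasIsolatedVertex-□ˡ (Gs zero) (⨀ n (Gs ∘ suc)) (noIsolated zero)) _)
  where
  ms : ∀ i → MirrorInvolution (Gs i)
  ms i = mirrorInvolution (Gs i) (h i)

corollary4p6 : (n : ℕ) → 1 < n → (Gs : Fin n → Graph) →
    ((∀ i → Σ (Vertex (Gs i) → Vertex (Gs i)) λ σ →
        IsAutomorphism (Gs i) σ × HasOrder2 (Gs i) σ
        × (∀ v → ¬ (σ v ≡ v)) × (∀ v → adj (Gs i) v (σ v) ≡ false))
      → IsPPosition (⨀ n Gs))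
    ×
    ((∀ i → ¬ HasIsolatedVertex (Gs i))
      → (∀ i → Σ (Vertex (Gs i) → Vertex (Gs i)) λ σ →
          IsAutomorphism (Gs i) σ × HasOrder2 (Gs i) σ
          × (Σ (Vertex (Gs i)) λ w → σ w ≡ w × (∀ u → σ u ≡ u → u ≡ w))
          × (∀ v → adj (Gs i) v (σ v) ≡ false))
      → IsNPosition (⨀ n Gs))
corollary4p6 (suc n) _ Gs = ⨀-P-position n Gs , ⨀-N-position n Gs
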